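{- Let $\mathbb{F}_4=\{0,1,\omega,\omega+1\}$ (so $\omega^2=\omega+1$) and \[ G_1=\begin{pmatrix}1&\omega&0&\omega+1\\0&0&1&\omega\end{pmatrix}\in\mathbb{F}_4^{2\times4}, \] and let $\mathcal{M}_1=\mathcal{M}_{G_1}=(\mathbb{F}_2^4,\rho_1)$. Then $\mathcal{M}_1\oplus\mathcal{M}_1$ is not representable over any field extension $\mathbb{F}_{2^m}$ of $\mathbb{F}_2$.
   Context: A $q$-matroid with ground space $E$ (a finite-dimensional $\mathbb{F}_q$-vector space) is a pair $(E,\rho)$ with $\rho$ from the subspaces of $E$ to $\mathbb{N}_{\ge0}$ satisfying $0\le\rho(V)\le\dim V$, monotonicity, and submodularity $\rho(V+W)+\rho(V\cap W)\le\rho(V)+\rho(W)$. For $G\in\mathbb{F}_{q^m}^{k\times n}$, $\mathcal{M}_G=(\mathbb{F}_q^n,\rho_G)$ with $\rho_G(V)=\operatorname{rk}_{\mathbb{F}_{q^m}}(GY^{\mathsf T})$ for any $\mathbb{F}_q$-matrix $Y$ with $n$ columns and row space $V$. A $q$-matroid on $\mathbb{F}_q^n$ is representable over $\mathbb{F}_{q^m}$ if it equals (has the same rank function as) $\mathcal{M}_G$ for some matrix $G$ over $\mathbb{F}_{q^m}$ with $n$ columns. Direct sum: for $q$-matroids $\mathcal{M}_i=(\mathbb{F}_q^{n_i},\rho_i)$ and $n=n_1+n_2$, write $\mathbb{F}_q^n=\mathbb{F}_q^{n_1}\oplus\mathbb{F}_q^{n_2}$ with $\pi_1,\pi_2$ the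 projections onto the first $n_1$ and last $n_2$ coordinates; put $\rho_i'(V)=\rho_i(\pi_i(V))$, $\mathcal{X}=\{X\le\mathbb{F}_q^n\mid\rho_1'(X)+\rho_2'(X)<\dim X\}$, $\mathcal{X}_0=\mathcal{X}\cup\{0\}$; then $\mathcal{M}_1\oplus\mathcal{M}_2=(\mathbb{F}_q^n,\rho)$ with $\rho(V)=\dim V+\min_{X\in\mathcal{X}_0,\,X\le V}(\rho_1'(X)+\rho_2'(X)-\dim X)$. -}

module Defs where

open import Level using (0ℓ)
open import Data.Bool using (Bool; true; false; _xor_; _∧_; _∨_; not; if_then_else_)
open import Data.Nat using (ℕ; zero; suc; _∸_; _≤_; _<_; _⊔_; _^_)
open import Data.Nat as ℕ using ()
open import Data.Fin using (Fin; zero; suc; punchIn; toℕ; _↑ˡ_; _↑ʳ_)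
import Data.Fin.Properties as FinP
open import Data.List using (List; []; _∷_; map; _++_; foldr; upTo)
open import Data.Bool.ListAction using (any)
open import Data.Product using (Σ; _×_; _,_; ∃)
open import Data.Sum using (_⊎_)
open import Relation.Nullary using (¬_; Dec; yes; no; does)
open import Relation.Binary.PropositionalEquality as ≡ using (_≡_)
open import Algebra.Bundles using (CommutativeRing)
open import Function.Bundles using (Inverse; Injection)
open import Function.Properties.Inverse using (Inverse⇒Injection)

record Field : Set₁ where
  field
    commutativeRing : CommutativeRing 0ℓ 0ℓ
  open CommutativeRing commutativeRing public
  field
    0≉1 : ¬ (0# ≈ 1#)
    inverse : ∀ x → ¬ (x ≈ 0#) → Σ Carrier λ y → (x * y) ≈ 1#

FiniteOfOrder : Field → ℕ → Set
FiniteOfOrder K N = Inverse (Field.setoid K) (≡.setoid (Fin N))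

Matrix : Set → ℕ → ℕ → Set
Matrix A m n = Fin m → Fin n → A

record RankData : Set₁ where
  field
    Carrier : Set
    0# 1#   : Carrier
    _+_ _*_ : Carrier → Carrier → Carrier
    -_      : Carrier → Carrier
    isZero  : Carrier → Bool

module RankOver (D : RankData) where
  open RankData D

  ∑ : ∀ {n} → (Fin n → Carrier) → Carrier
  ∑ {zero}  f = 0#
  ∑ {suc n} f = f zero + ∑ (λ i → f (suc i))

  signed : ℕ → Carrier → Carrier
  signed zero          x = x
  signed (suc zero)    x = - x
  signed (suc (suc j)) x = signed j x

  det : ∀ {n} → Matrix Carrier n n → Carrier
  det {zero}  A = 1#
  det {suc n} A = ∑ λ j → signed (toℕ j)
                    (A zero j * det (λ i k → A (suc i) (punchIn j k)))

  -- all strictly increasing maps Fin r → Fin m (r-element subsets)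
  choose : (r m : ℕ) → List (Fin r → Fin m)
  choose zero    m       = (λ ()) ∷ []
  choose (suc r) zero    = []
  choose (suc r) (suc m) =
    map (λ f i → suc (f i)) (choose (suc r) m)
    ++ map (λ f → λ { zero → zero ; (suc i) → suc (f i) }) (choose r m)

  hasNonzeroMinor : ∀ {m n} → Matrix Carrier m n → ℕ → Bool
  hasNonzeroMinor {m} {n} A r =
    any (λ rows → any (λ cols → not (isZero (det (λ i j → A (rows i) (cols j)))))
                      (choose r n))
        (choose r m)

  rank : ∀ {m n} → Matrix Carrier m n → ℕ
  rank {m} A = foldr _⊔_ 0
    (map (λ r → if hasNonzeroMinor A r then r else 0) (upTo (suc m)))

F₂ : RankData
F₂ = record { Carrier = Bool ; 0# = false ; 1# = true ; _+_ = _xor_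
            ; _*_ = _∧_ ; -_ = λ x → x ; isZero = not }

_·₂_ : ∀ {a b c} → Matrix Bool a b → Matrix Bool b c → Matrix Bool a c
(C ·₂ Y) i j = RankOver.∑ F₂ (λ l → C i l ∧ Y l j)

dim : ∀ {r n} → Matrix Bool r n → ℕ
dim = RankOver.rank F₂

-- A subspace of F₂ⁿ is represented by any F₂-matrix whose row space it is.
-- Z ≤ Y : the row space of Z is contained in the row space of Y.
_≤ₛ_ : ∀ {s r n} → Matrix Bool s n → Matrix Bool r n → Set
_≤ₛ_ {s} {r} Z Y = Σ (Matrix Bool s r) λ C → ∀ i j → Z i j ≡ (C ·₂ Y) i j

RankFn : ℕ → Set
RankFn n = ∀ {r} → Matrix Bool r n → ℕ

decZero : (K : Field) {N : ℕ} → FiniteOfOrder K N →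
          ∀ x → Dec (Field._≈_ K x (Field.0# K))
decZero K fin x with Inverse.to fin x FinP.≟ Inverse.to fin (Field.0# K)
... | yes p = yes (Injection.injective (Inverse⇒Injection fin) p)
... | no ¬p = no (λ q → ¬p (Inverse.to-cong fin q))

rankDataOf : (K : Field) {N : ℕ} → FiniteOfOrder K N → RankData
rankDataOf K fin = record
  { Carrier = Field.Carrier K ; 0# = Field.0# K ; 1# = Field.1# K
  ; _+_ = Field._+_ K ; _*_ = Field._*_ K ; -_ = Field.-_ K
  ; isZero = λ x → does (decZero K fin x) }

-- ρ_G(V) = rk(G Yᵀ), Y an F₂-matrix with row space V (F₂ ⊆ K via 0,1)
ρ[_,_] : (K : Field) {N : ℕ} (fin : FiniteOfOrder K N) {k n : ℕ} →
         Matrix (Field.Carrier K) k n → RankFn n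
ρ[ K , fin ] G Y = RankOver.rank (rankDataOf K fin)
  (λ i j → RankOver.∑ (rankDataOf K fin)
     (λ l → Field._*_ K (G i l) (if Y j l then Field.1# K else Field.0# K)))

-- Representable over F_{2^m}: there is a field K of order 2^m and a
-- matrix G over K with n columns whose q-matroid has the given rank function
-- (given as a relation "rank of V is v").
RepresentableOver : ℕ → (n : ℕ) → (∀ {r} → Matrix Bool r n → ℕ → Set) → Set₁
RepresentableOver m n P =
  Σ Field λ K → Σ (FiniteOfOrder K (2 ^ m)) λ fin →
    Σ ℕ λ k → Σ (Matrix (Field.Carrier K) k n) λ G →
      ∀ {r} (Y : Matrix Bool r n) → P Y (ρ[ K , fin ] G Y)

module DirectSum {n₁ n₂ : ℕ} (ρ₁ : RankFn n₁) (ρ₂ : RankFn n₂) where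

  π₁ : ∀ {r} → Matrix Bool r (n₁ ℕ.+ n₂) → Matrix Bool r n₁
  π₁ Y i j = Y i (j ↑ˡ n₂)

  π₂ : ∀ {r} → Matrix Bool r (n₁ ℕ.+ n₂) → Matrix Bool r n₂
  π₂ Y i j = Y i (n₁ ↑ʳ j)

  ρ₁′ ρ₂′ : RankFn (n₁ ℕ.+ n₂)
  ρ₁′ X = ρ₁ (π₁ X)
  ρ₂′ X = ρ₂ (π₂ X)

  In𝒳₀ : ∀ {s} → Matrix Bool s (n₁ ℕ.+ n₂) → Set
  In𝒳₀ X = (ρ₁′ X ℕ.+ ρ₂′ X < dim X) ⊎ (dim X ≡ 0)

  -- dim V + (ρ₁′(X) + ρ₂′(X) − dim X), computed in ℕ (exact since X ≤ V)
  candidate : ∀ {r s} → Matrix Bool r (n₁ ℕ.+ n₂) → Matrix Bool s (n₁ ℕ.+ n₂) → ℕ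
  candidate V X = (dim V ℕ.+ (ρ₁′ X ℕ.+ ρ₂′ X)) ∸ dim X

  RankIs : ∀ {r} → Matrix Bool r (n₁ ℕ.+ n₂) → ℕ → Set
  RankIs V v =
    (Σ ℕ λ s → Σ (Matrix Bool s (n₁ ℕ.+ n₂)) λ X →
        X ≤ₛ V × In𝒳₀ X × v ≡ candidate V X)
    × (∀ {s} (X : Matrix Bool s (n₁ ℕ.+ n₂)) → X ≤ₛ V → In𝒳₀ X → v ≤ candidate V X)

-- F₄ = {0, 1, ω, ω+1}, ω² = ω + 1.  Element a + bω is written ⟨ a , b ⟩.

data F₄ : Set where
  ⟨_,_⟩ : Bool → Bool → F₄

𝟘 𝟙 ω ω+1 : F₄
𝟘   = ⟨ false , false ⟩
𝟙   = ⟨ true  , false ⟩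
ω   = ⟨ false , true  ⟩
ω+1 = ⟨ true  , true  ⟩

-- (a + bω)(c + dω) = (ac + bd) + (ad + bc + bd)ω   using ω² = ω + 1
F₄-data : RankData
F₄-data = record
  { Carrier = F₄ ; 0# = 𝟘 ; 1# = 𝟙
  ; _+_ = λ { ⟨ a , b ⟩ ⟨ c , d ⟩ → ⟨ a xor c , b xor d ⟩ }
  ; _*_ = λ { ⟨ a , b ⟩ ⟨ c , d ⟩ →
              ⟨ (a ∧ c) xor (b ∧ d) , ((a ∧ d) xor (b ∧ c)) xor (b ∧ d) ⟩ }
  ; -_ = λ x → x
  ; isZero = λ { ⟨ a , b ⟩ → not (a ∨ b) } }

G₁ : Matrix F₄ 2 4
G₁ zero       = λ { zero → 𝟙 ; (suc zero) → ω ; (suc (suc zero)) → 𝟘 ; (suc (suc (suc zero))) → ω+1 }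
G₁ (suc zero) = λ { zero → 𝟘 ; (suc zero) → 𝟘 ; (suc (suc zero)) → 𝟙 ; (suc (suc (suc zero))) → ω }

ρ₁ : RankFn 4
ρ₁ Y = RankOver.rank F₄-data
  (λ i j → RankOver.∑ F₄-data
     (λ l → RankData._*_ F₄-data (G₁ i l) (if Y j l then 𝟙 else 𝟘)))

-- Let G represent M₁ ⊕ M₁ over a field K of order 2^m and write φ y = G y for y ∈ F₂⁸.  A line V (a
-- 2-dimensional subspace) lying in 𝒳 has rank at most 1, so φ maps it to parallel vectors; a line none
-- of whose subspaces lies in 𝒳 has rank 2, so φ maps it to independent vectors.  In either half F₂⁴ of
-- F₂⁸ the five lines of rank one of M₁ (an F₄-spread) lie in 𝒳.  Writing φ in the basis φ e₀, φ e₂ of the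
-- image of a half, parallelism on the spread gives φ e₁ = α φ e₀, and three polynomial equations which
-- force char K = 2 and α² + α + 1 = 0.  For the roots α, β obtained from the two halves, either α = β, and
-- then the diagonal line ⟨e₀ + e₄, e₁ + e₅⟩ is mapped to parallel vectors, or β = α + 1, and then the line
-- ⟨e₀ + e₄, e₁ + e₄ + e₅⟩ is.  Neither of these lines has a subspace in 𝒳, a contradiction.  All facts
-- about the concrete q-matroid M₁ ⊕ M₁ are decided by evaluation.

module Submission where

open import Algebra.Bundles using (CommutativeRing)
open import Data.Bool.Base using (Bool; true; false; T; not; _∧_; _∨_; _xor_; if_then_else_)
open import Data.Bool.ListAction using (or)
open import Data.Bool.Properties using (T-∧; T-∨; T-not-≡; ∧-zeroʳ; xor-identityʳ)
open import Data.Empty using (⊥; ⊥-elim)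
open import Data.Fin.Base using (Fin; zero; suc; toℕ; punchIn; _↑ˡ_; _↑ʳ_)
import Data.Fin.Properties as Fin
open import Data.Integer.Base as ℤ using (ℤ; +_; -[1+_]; _⊖_; sign; ∣_∣; _◃_)
import Data.Integer.Properties as ℤ
open import Data.List.Base using (map; foldr; upTo)
open import Data.List.Membership.Propositional using (_∈_; find; lose)
open import Data.List.Membership.Propositional.Properties
  using (∈-map⁺; ∈-map⁻; ∈-++⁺ˡ; ∈-++⁺ʳ; ∈-++⁻; ∈-upTo⁺)
open import Data.List.Properties using (foldr-preservesᵇ; foldr-preservesᵒ; map-cong)
open import Data.List.Relation.Unary.All as All using (All)
import Data.List.Relation.Unary.All.Properties as All
open import Data.List.Relation.Unary.Any using (here)
open import Data.List.Relation.Unary.Any.Properties using (any⁺; any⁻)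
open import Data.Maybe.Base as Maybe using (Maybe)
open import Data.Nat.Base as ℕ using (ℕ; zero; suc; _≤_; _<_; _⊔_; z≤n; s≤s)
import Data.Nat.Properties as ℕ
open import Data.Product.Base using (Σ; _×_; _,_; proj₁; proj₂)
open import Data.Sign.Base as Sign using (Sign)
open import Data.Sum.Base using (_⊎_; inj₁; inj₂; [_,_]′)
open import Data.Vec.Base using (Vec; []; _∷_; lookup)
open import Data.Vec.Functional using (_++_)
open import Data.Vec.Functional.Properties using (lookup-++ˡ; lookup-++ʳ)
open import Function.Base using (_∘_; case_of_)
open import Function.Bundles using (Equivalence; _⇔_; mk⇔)
open import Relation.Binary.Consequences using (dec⇒weaklyDec)
open import Relation.Binary.Definitions using (tri<; tri≈; tri>)
open import Relation.Binary.PropositionalEquality as ≡ using (_≡_)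
open import Relation.Nullary using (¬_; yes; no)
open import Relation.Nullary.Decidable using (dec-true; dec-false; decidable-stable)

open import Defs

-- The library's ring solvers for an arbitrary commutative ring compute with coefficients in the ring
-- itself, where cancellations such as 1 - 1 = 0 cannot be evaluated; here the coefficients are integers,
-- interpreted in R.
module IntegerCoefficientSolver {c ℓ} (R : CommutativeRing c ℓ) where
  open CommutativeRing R
  open import Algebra.Properties.Ring ring
  open import Algebra.Properties.CommutativeSemigroup +-commutativeSemigroup using (interchange)
  open import Algebra.Properties.Semiring.Mult.TCOptimised semiring using (1+×; ×-homo-+; ×1-homo-*)
    renaming (_×_ to _×ₙ_)
  open import Algebra.Solver.Ring.AlmostCommutativeRing
  open import Relation.Binary.Reasoning.Setoid setoid

  ⟦_⟧ℤ : ℤ → Carrier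
  ⟦ + n ⟧ℤ      = n ×ₙ 1#
  ⟦ -[1+ n ] ⟧ℤ = - (suc n ×ₙ 1#)

  private
    ⊖-homo : ∀ m n → ⟦ m ⊖ n ⟧ℤ ≈ m ×ₙ 1# - n ×ₙ 1#
    ⊖-homo m       zero    = sym (trans (+-congˡ -0#≈0#) (+-identityʳ _))
    ⊖-homo zero    (suc n) = sym (+-identityˡ _)
    ⊖-homo (suc m) (suc n) = begin
      ⟦ suc m ⊖ suc n ⟧ℤ                ≡⟨ ≡.cong ⟦_⟧ℤ (ℤ.[1+m]⊖[1+n]≡m⊖n m n) ⟩
      ⟦ m ⊖ n ⟧ℤ                        ≈⟨ ⊖-homo m n ⟩
      m ×ₙ 1# - n ×ₙ 1#                   ≈⟨ +-identityˡ _ ⟨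
      0# + (m ×ₙ 1# - n ×ₙ 1#)            ≈⟨ +-congʳ (-‿inverseʳ 1#) ⟨
      (1# - 1#) + (m ×ₙ 1# - n ×ₙ 1#)     ≈⟨ interchange 1# (m ×ₙ 1#) (- 1#) (- (n ×ₙ 1#)) ⟨
      (1# + m ×ₙ 1#) + (- 1# - n ×ₙ 1#)   ≈⟨ +-congˡ (-‿+-comm 1# (n ×ₙ 1#)) ⟩
      (1# + m ×ₙ 1#) - (1# + n ×ₙ 1#)     ≈⟨ +-cong (1+× m 1#) (-‿cong (1+× n 1#)) ⟨
      suc m ×ₙ 1# - suc n ×ₙ 1#           ∎

    +-homo : ∀ i j → ⟦ i ℤ.+ j ⟧ℤ ≈ ⟦ i ⟧ℤ + ⟦ j ⟧ℤ
    +-homo (+ m)    (+ n)    = ×-homo-+ 1# m n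
    +-homo (+ m)    -[1+ n ] = ⊖-homo m (suc n)
    +-homo -[1+ m ] (+ n)    = trans (⊖-homo n (suc m)) (+-comm _ _)
    +-homo -[1+ m ] -[1+ n ] = begin
      - (suc (suc (m ℕ.+ n)) ×ₙ 1#)       ≡⟨ ≡.cong (λ k → - (k ×ₙ 1#)) (ℕ.+-suc (suc m) n) ⟨
      - ((suc m ℕ.+ suc n) ×ₙ 1#)         ≈⟨ -‿cong (×-homo-+ 1# (suc m) (suc n)) ⟩
      - (suc m ×ₙ 1# + suc n ×ₙ 1#)        ≈⟨ -‿+-comm _ _ ⟨
      - (suc m ×ₙ 1#) - (suc n ×ₙ 1#)      ∎

    signed : Sign → Carrier → Carrier
    signed Sign.+ x = x
    signed Sign.- x = - x

    ◃-homo : ∀ s n → ⟦ s ◃ n ⟧ℤ ≈ signed s (n ×ₙ 1#)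
    ◃-homo Sign.+ zero    = refl
    ◃-homo Sign.- zero    = sym -0#≈0#
    ◃-homo Sign.+ (suc n) = refl
    ◃-homo Sign.- (suc n) = refl

    signed-* : ∀ s t x y → signed (s Sign.* t) (x * y) ≈ signed s x * signed t y
    signed-* Sign.+ Sign.+ x y = refl
    signed-* Sign.+ Sign.- x y = -‿distribʳ-* x y
    signed-* Sign.- Sign.+ x y = -‿distribˡ-* x y
    signed-* Sign.- Sign.- x y = begin
      x * y          ≈⟨ -‿involutive _ ⟨
      - - (x * y)    ≈⟨ -‿cong (-‿distribˡ-* x y) ⟩
      - (- x * y)    ≈⟨ -‿distribʳ-* (- x) y ⟩
      - x * - y      ∎

    signed-cong : ∀ s {x y} → x ≈ y → signed s x ≈ signed s y
    signed-cong Sign.+ x≈y = x≈y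
    signed-cong Sign.- x≈y = -‿cong x≈y

    *-homo : ∀ i j → ⟦ i ℤ.* j ⟧ℤ ≈ ⟦ i ⟧ℤ * ⟦ j ⟧ℤ
    *-homo i j = begin
      ⟦ s ◃ ∣ i ∣ ℕ.* ∣ j ∣ ⟧ℤ                                    ≈⟨ ◃-homo s (∣ i ∣ ℕ.* ∣ j ∣) ⟩
      signed s ((∣ i ∣ ℕ.* ∣ j ∣) ×ₙ 1#)                         ≈⟨ signed-cong s (×1-homo-* ∣ i ∣ ∣ j ∣) ⟩
      signed s (∣ i ∣ ×ₙ 1# * ∣ j ∣ ×ₙ 1#)                        ≈⟨ signed-* (sign i) (sign j) _ _ ⟩
      signed (sign i) (∣ i ∣ ×ₙ 1#) * signed (sign j) (∣ j ∣ ×ₙ 1#) ≈⟨ *-cong (sign-abs i) (sign-abs j) ⟩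
      ⟦ i ⟧ℤ * ⟦ j ⟧ℤ                                             ∎
      where
      s : Sign
      s = sign i Sign.* sign j
      sign-abs : ∀ i → signed (sign i) (∣ i ∣ ×ₙ 1#) ≈ ⟦ i ⟧ℤ
      sign-abs (+ n)    = refl
      sign-abs -[1+ n ] = refl

    -‿homo : ∀ i → ⟦ ℤ.- i ⟧ℤ ≈ - ⟦ i ⟧ℤ
    -‿homo (+ zero)  = sym -0#≈0#
    -‿homo (+ suc n) = refl
    -‿homo -[1+ n ]  = sym (-‿involutive _)

    ℤ⟶R : ℤ.+-*-rawRing -Raw-AlmostCommutative⟶ fromCommutativeRing R
    ℤ⟶R = record
      { ⟦_⟧ = ⟦_⟧ℤ ; +-homo = +-homo ; *-homo = *-homo ; -‿homo = -‿homo
      ; 0-homo = refl ; 1-homo = refl }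

    _≟ℤ_ : ∀ i j → Maybe (⟦ i ⟧ℤ ≈ ⟦ j ⟧ℤ)
    i ≟ℤ j = Maybe.map (λ i≡j → reflexive (≡.cong ⟦_⟧ℤ i≡j)) (dec⇒weaklyDec ℤ._≟_ i j)

  open import Algebra.Solver.Ring ℤ.+-*-rawRing (fromCommutativeRing R) ℤ⟶R _≟ℤ_ public

pair : ∀ {a} {X : Set a} → X → X → Fin 2 → X
pair x y zero       = x
pair x y (suc zero) = y

pair-η : ∀ {a} {X : Set a} (f : Fin 2 → X) i → f i ≡ pair (f zero) (f (suc zero)) i
pair-η f zero       = ≡.refl
pair-η f (suc zero) = ≡.refl

allBits : ∀ n → (Vec Bool n → Bool) → Bool
allBits zero    f = f []
allBits (suc n) f = allBits n (f ∘ (true ∷_)) ∧ allBits n (f ∘ (false ∷_))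

_⇒ᵇ_ : Bool → Bool → Bool
a ⇒ᵇ b = not a ∨ b

T-⇒ᵇ : ∀ {a b} → T (a ⇒ᵇ b) → T a → T b
T-⇒ᵇ {true} b _ = b

allBits-sound : ∀ n (f : Vec Bool n → Bool) → T (allBits n f) → ∀ v → T (f v)
allBits-sound zero    f holds [] = holds
allBits-sound (suc n) f holds (true ∷ v)  = allBits-sound n _ (proj₁ (Equivalence.to T-∧ holds)) v
allBits-sound (suc n) f holds (false ∷ v) = allBits-sound n _ (proj₂ (Equivalence.to T-∧ holds)) v

disjoint : ∀ {n} → (Fin n → Bool) → (Fin n → Bool) → Bool
disjoint {zero}  _ _  = true
disjoint {suc n} y y′ = not (y zero ∧ y′ zero) ∧ disjoint (y ∘ suc) (y′ ∘ suc)

∅ : ∀ {n} → Fin n → Bool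
∅ _ = false

_∪_ : ∀ {n} → (Fin n → Bool) → (Fin n → Bool) → Fin n → Bool
(y ∪ y′) l = y l ∨ y′ l

e₀ e₁ e₂ e₃ : Fin 4 → Bool
e₀ = lookup (true  ∷ false ∷ false ∷ false ∷ [])
e₁ = lookup (false ∷ true  ∷ false ∷ false ∷ [])
e₂ = lookup (false ∷ false ∷ true  ∷ false ∷ [])
e₃ = lookup (false ∷ false ∷ false ∷ true  ∷ [])

-- G₁ identifies F₂⁴ with F₄², sending e₀, e₁, e₂, e₃ to (1,0), (ω,0), (0,1), (ω+1,ω); the lines below
-- are the preimages of the five F₄-lines of F₄², i.e. the lines of rank one in M₁.
spread : Fin 5 → Matrix Bool 2 4
spread zero                         = pair e₀ e₁
spread (suc zero)                   = pair e₂ (e₀ ∪ (e₁ ∪ e₃))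
spread (suc (suc zero))             = pair (e₀ ∪ e₂) (e₀ ∪ e₃)
spread (suc (suc (suc zero)))       = pair (e₁ ∪ e₃) (e₀ ∪ (e₂ ∪ e₃))
spread (suc (suc (suc (suc zero)))) = pair e₃ (e₁ ∪ (e₂ ∪ e₃))

module RankLemmas (D : RankData) where
  open RankData D
  open RankOver D

  minor : ∀ {m n r} → Matrix Carrier m n → (Fin r → Fin m) → (Fin r → Fin n) → Carrier
  minor A rows cols = det (λ i j → A (rows i) (cols j))

  NonzeroMinor : ∀ {m n} → Matrix Carrier m n → ℕ → Set
  NonzeroMinor {m} {n} A r =
    Σ (Fin r → Fin m) λ rows → Σ (Fin r → Fin n) λ cols →
      rows ∈ choose r m × cols ∈ choose r n × T (not (isZero (minor A rows cols)))

  hasNonzeroMinor⁻ : ∀ {m n} (A : Matrix Carrier m n) r →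
                     T (hasNonzeroMinor A r) → NonzeroMinor A r
  hasNonzeroMinor⁻ {m} {n} A r h
    with rows , rows∈ , h′ ← find (any⁻ _ (choose r m) h)
    with cols , cols∈ , nz ← find (any⁻ _ (choose r n) h′)
    = rows , cols , rows∈ , cols∈ , nz

  hasNonzeroMinor⁺ : ∀ {m n} (A : Matrix Carrier m n) r →
                     NonzeroMinor A r → T (hasNonzeroMinor A r)
  hasNonzeroMinor⁺ A r (rows , cols , rows∈ , cols∈ , nz) =
    any⁺ _ (lose rows∈ (any⁺ _ (lose cols∈ nz)))

  ∈-choose⇒≤ : ∀ {r m} {f : Fin r → Fin m} → f ∈ choose r m → r ≤ m
  ∈-choose⇒≤ {zero}          _   = z≤n
  ∈-choose⇒≤ {suc r} {suc m} f∈ with ∈-++⁻ (map _ (choose (suc r) m)) f∈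
  ... | inj₁ f∈ˡ with _ , g∈ , _ ← ∈-map⁻ _ f∈ˡ = ℕ.m≤n⇒m≤1+n (∈-choose⇒≤ g∈)
  ... | inj₂ f∈ʳ with _ , g∈ , _ ← ∈-map⁻ _ f∈ʳ = s≤s (∈-choose⇒≤ g∈)

  NonzeroMinor⇒≤rows : ∀ {m n} {A : Matrix Carrier m n} {r} → NonzeroMinor A r → r ≤ m
  NonzeroMinor⇒≤rows (_ , _ , rows∈ , _) = ∈-choose⇒≤ rows∈

  NonzeroMinor⇒≤cols : ∀ {m n} {A : Matrix Carrier m n} {r} → NonzeroMinor A r → r ≤ n
  NonzeroMinor⇒≤cols (_ , _ , _ , cols∈ , _) = ∈-choose⇒≤ cols∈

  private
    sizeIfMinor : ∀ {m n} → Matrix Carrier m n → ℕ → ℕ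
    sizeIfMinor A r = if hasNonzeroMinor A r then r else 0

  NonzeroMinor⇒≤rank : ∀ {m n} (A : Matrix Carrier m n) {r} → NonzeroMinor A r → r ≤ rank A
  NonzeroMinor⇒≤rank {m} A {r} minorA =
    foldr-preservesᵒ {P = r ≤_} (λ x y → [ ℕ.m≤n⇒m≤n⊔o y , ℕ.m≤n⇒m≤o⊔n x ]′)
      0 (map (sizeIfMinor A) (upTo (suc m)))
      (inj₂ (lose (∈-map⁺ (sizeIfMinor A) (∈-upTo⁺ (s≤s (NonzeroMinor⇒≤rows {A = A} minorA)))) r≤size))
    where
    r≤size : r ≤ sizeIfMinor A r
    r≤size with hasNonzeroMinor A r | hasNonzeroMinor⁺ A r minorA
    ... | true | _ = ℕ.≤-refl

  rank≡0⊎NonzeroMinor : ∀ {m n} (A : Matrix Carrier m n) → rank A ≡ 0 ⊎ NonzeroMinor A (rank A)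
  rank≡0⊎NonzeroMinor {m} A with
    foldr-preservesᵇ {P = Witnessed} join (inj₁ ≡.refl)
      (All.map⁺ {xs = upTo (suc m)} (All.universal witnessed _))
    where
    Witnessed : ℕ → Set
    Witnessed s = s ≡ 0 ⊎ T (hasNonzeroMinor A s)
    witnessed : ∀ r → Witnessed (sizeIfMinor A r)
    witnessed r with hasNonzeroMinor A r in eq
    ... | true  = inj₂ (≡.subst T (≡.sym eq) _)
    ... | false = inj₁ ≡.refl
    join : ∀ {x y} → Witnessed x → Witnessed y → Witnessed (x ⊔ y)
    join {x} {y} wx wy with ℕ.⊔-sel x y
    ... | inj₁ eq = ≡.subst Witnessed (≡.sym eq) wx
    ... | inj₂ eq = ≡.subst Witnessed (≡.sym eq) wy
  ... | inj₁ rank≡0 = inj₁ rank≡0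
  ... | inj₂ minorA = inj₂ (hasNonzeroMinor⁻ A (rank A) minorA)

  rank≡suc⇒NonzeroMinor : ∀ {m n} (A : Matrix Carrier m n) {r} → rank A ≡ suc r → NonzeroMinor A (suc r)
  rank≡suc⇒NonzeroMinor A rank≡ with rank≡0⊎NonzeroMinor A
  ... | inj₁ rank≡0 = ⊥-elim (ℕ.0≢1+n (≡.trans (≡.sym rank≡0) rank≡))
  ... | inj₂ minorA = ≡.subst (NonzeroMinor A) rank≡ minorA

  ∑-cong : ∀ {n} {f g : Fin n → Carrier} → (∀ i → f i ≡ g i) → ∑ f ≡ ∑ g
  ∑-cong {zero}  _   = ≡.refl
  ∑-cong {suc n} f≗g = ≡.cong₂ _+_ (f≗g zero) (∑-cong (f≗g ∘ suc))

  det-cong : ∀ {n} {A B : Matrix Carrier n n} → (∀ i j → A i j ≡ B i j) → det A ≡ det B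
  det-cong {zero}  _   = ≡.refl
  det-cong {suc n} A≗B = ∑-cong λ j → ≡.cong (signed (toℕ j))
    (≡.cong₂ _*_ (A≗B zero j) (det-cong λ i k → A≗B (suc i) (punchIn j k)))

  minor-cong : ∀ {m n r} (A : Matrix Carrier m n) {rows rows′ : Fin r → Fin m} {cols cols′ : Fin r → Fin n} →
               (∀ i → rows i ≡ rows′ i) → (∀ j → cols j ≡ cols′ j) →
               minor A rows cols ≡ minor A rows′ cols′
  minor-cong A rows≗ cols≗ = det-cong λ i j → ≡.cong₂ A (rows≗ i) (cols≗ j)

  rank-cong : ∀ {m n} {A B : Matrix Carrier m n} → (∀ i j → A i j ≡ B i j) → rank A ≡ rank B
  rank-cong {m} {n} {A} {B} A≗B = ≡.cong (foldr _⊔_ 0) (map-cong sizeIfMinor-cong (upTo (suc m)))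
    where
    sizeIfMinor-cong : ∀ r → sizeIfMinor A r ≡ sizeIfMinor B r
    sizeIfMinor-cong r = ≡.cong (if_then r else 0) (≡.cong or (map-cong (λ rows → ≡.cong or
      (map-cong (λ cols → ≡.cong (not ∘ isZero) (det-cong λ i j → A≗B (rows i) (cols j)))
        (choose r n))) (choose r m)))

  choose-single : ∀ {m} (t : Fin m) → Σ (Fin 1 → Fin m) λ f → f ∈ choose 1 m × (∀ i → f i ≡ t)
  choose-single {suc m} zero    = _ , ∈-++⁺ʳ (map _ (choose 1 m)) (here ≡.refl) , λ { zero → ≡.refl }
  choose-single {suc m} (suc t) with f , f∈ , f≗t ← choose-single t =
    _ , ∈-++⁺ˡ (∈-map⁺ _ f∈) , λ i → ≡.cong suc (f≗t i)

  choose-pair : ∀ {m} {t t′ : Fin m} → toℕ t < toℕ t′ →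
                Σ (Fin 2 → Fin m) λ f → f ∈ choose 2 m × (∀ i → f i ≡ pair t t′ i)
  choose-pair {suc m} {zero} {suc t′} _ with f , f∈ , f≗t′ ← choose-single t′ =
    _ , ∈-++⁺ʳ (map _ (choose 2 m)) (∈-map⁺ _ f∈) , λ { zero → ≡.refl ; (suc zero) → ≡.cong suc (f≗t′ zero) }
  choose-pair {suc m} {suc t} {suc t′} (s≤s t<t′) with f , f∈ , f≗ ← choose-pair t<t′ =
    _ , ∈-++⁺ˡ (∈-map⁺ _ f∈) , λ { zero → ≡.cong suc (f≗ zero) ; (suc zero) → ≡.cong suc (f≗ (suc zero)) }

  choose-pair-increasing : ∀ {m} {f : Fin 2 → Fin m} → f ∈ choose 2 m → toℕ (f zero) < toℕ (f (suc zero))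
  choose-pair-increasing {suc m} f∈ with ∈-++⁻ (map _ (choose 2 m)) f∈
  ... | inj₁ f∈ˡ with _ , g∈ , ≡.refl ← ∈-map⁻ _ f∈ˡ = s≤s (choose-pair-increasing g∈)
  ... | inj₂ f∈ʳ with _ , _  , ≡.refl ← ∈-map⁻ _ f∈ʳ = s≤s z≤n

  choose-2-2 : ∀ {f : Fin 2 → Fin 2} → f ∈ choose 2 2 → ∀ i → f i ≡ pair zero (suc zero) i
  choose-2-2 (here ≡.refl) zero       = ≡.refl
  choose-2-2 (here ≡.refl) (suc zero) = ≡.refl

  entry⇒1≤rank : ∀ {m n} (A : Matrix Carrier m n) i j →
                 T (not (isZero (minor {r = 1} A (λ _ → i) (λ _ → j)))) → 1 ≤ rank A
  entry⇒1≤rank A i j nz with rows , rows∈ , rows≗ ← choose-single i | cols , cols∈ , cols≗ ← choose-single j =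
    NonzeroMinor⇒≤rank A (rows , cols , rows∈ , cols∈ ,
      ≡.subst (T ∘ not ∘ isZero) (≡.sym (minor-cong A rows≗ cols≗)) nz)

  minor₂⇒2≤rank : ∀ {m n} (A : Matrix Carrier m n) {t t′ j j′} → toℕ t < toℕ t′ → toℕ j < toℕ j′ →
                  T (not (isZero (minor A (pair t t′) (pair j j′)))) → 2 ≤ rank A
  minor₂⇒2≤rank A t<t′ j<j′ nz
    with rows , rows∈ , rows≗ ← choose-pair t<t′ | cols , cols∈ , cols≗ ← choose-pair j<j′ =
    NonzeroMinor⇒≤rank A (rows , cols , rows∈ , cols∈ ,
      ≡.subst (T ∘ not ∘ isZero) (≡.sym (minor-cong A rows≗ cols≗)) nz)

module OverF₂ where
  open RankOver F₂ using (det; signed)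
  open RankLemmas F₂

  -- a uᵀ + b vᵀ, written exactly as the entries of C ·₂ V unfold
  rank2Form : ∀ {n} (a b u v : Fin n → Bool) → Matrix Bool n n
  rank2Form a b u v i j = (a i ∧ u j) xor ((b i ∧ v j) xor false)

  det-rank2Form : ∀ {n} (a b u v : Fin n → Bool) → 3 ≤ n → det (rank2Form a b u v) ≡ false
  det-rank2Form {1} _ _ _ _ (s≤s ())
  det-rank2Form {2} _ _ _ _ (s≤s (s≤s ()))
  det-rank2Form {3} a b u v _ = Equivalence.to T-not-≡ (allBits-sound 12 vanishes _
    (a zero ∷ a (suc zero) ∷ a (suc (suc zero)) ∷ b zero ∷ b (suc zero) ∷ b (suc (suc zero)) ∷
     u zero ∷ u (suc zero) ∷ u (suc (suc zero)) ∷ v zero ∷ v (suc zero) ∷ v (suc (suc zero)) ∷ []))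
    where
    vanishes : Vec Bool 12 → Bool
    vanishes (a₀ ∷ a₁ ∷ a₂ ∷ b₀ ∷ b₁ ∷ b₂ ∷ u₀ ∷ u₁ ∷ u₂ ∷ v₀ ∷ v₁ ∷ v₂ ∷ []) =
      not (det (rank2Form (lookup (a₀ ∷ a₁ ∷ a₂ ∷ [])) (lookup (b₀ ∷ b₁ ∷ b₂ ∷ []))
                          (lookup (u₀ ∷ u₁ ∷ u₂ ∷ [])) (lookup (v₀ ∷ v₁ ∷ v₂ ∷ []))))
  det-rank2Form {suc (suc (suc (suc n)))} a b u v _ = ∑-false λ j →
    ≡.trans (signed-F₂ (toℕ j) _)
      (≡.trans (≡.cong (rank2Form a b u v zero j ∧_)
                  (det-rank2Form (a ∘ suc) (b ∘ suc) (u ∘ punchIn j) (v ∘ punchIn j) (s≤s (s≤s (s≤s z≤n)))))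
               (∧-zeroʳ _))
    where
    signed-F₂ : ∀ k x → signed k x ≡ x
    signed-F₂ zero          x = ≡.refl
    signed-F₂ (suc zero)    x = ≡.refl
    signed-F₂ (suc (suc k)) x = signed-F₂ k x
    ∑-false : ∀ {n} {f : Fin n → Bool} → (∀ j → f j ≡ false) → RankOver.∑ F₂ f ≡ false
    ∑-false {zero}  _      = ≡.refl
    ∑-false {suc n} f≡false rewrite f≡false zero = ∑-false (f≡false ∘ suc)

  dim-·₂-≤2 : ∀ {s n} (C : Matrix Bool s 2) (V : Matrix Bool 2 n) → dim (C ·₂ V) ≤ 2
  dim-·₂-≤2 C V = ℕ.≮⇒≥ λ 2<dim → case rank≡0⊎NonzeroMinor (C ·₂ V) of λ where
    (inj₁ dim≡0) → ℕ.<⇒≢ (ℕ.<-trans (s≤s z≤n) 2<dim) (≡.sym dim≡0)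
    (inj₂ (rows , cols , _ , _ , nz)) → ≡.subst T
      (≡.cong not (≡.cong not (det-rank2Form (λ i → C (rows i) zero) (λ i → C (rows i) (suc zero))
        (λ j → V zero (cols j)) (λ j → V (suc zero) (cols j)) 2<dim))) nz

  combination : ∀ {n} → Matrix Bool 2 n → Bool → Bool → Fin n → Bool
  combination V p q j = (p ∧ V zero j) xor ((q ∧ V (suc zero) j) xor false)

  det₂ : Bool → Bool → Bool → Bool → Bool
  det₂ p q p′ q′ = (p ∧ q′) xor (q ∧ p′)

  dim≡1⇒nonzeroRow : ∀ {s n} (C : Matrix Bool s 2) (V : Matrix Bool 2 n) → dim (C ·₂ V) ≡ 1 →
                     Σ (Fin s) λ c → T (C c zero ∨ C c (suc zero))
  dim≡1⇒nonzeroRow C V dim≡1 with rows , cols , _ , _ , nz ← rank≡suc⇒NonzeroMinor (C ·₂ V) dim≡1 =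
    rows zero , nonzero (C (rows zero) zero) (C (rows zero) (suc zero)) _ _ nz
    where
    nonzero : ∀ p q x y → T (not (not ((((p ∧ x) xor ((q ∧ y) xor false)) ∧ true) xor false))) → T (p ∨ q)
    nonzero true  _     _ _ _ = _
    nonzero false true  _ _ _ = _

  dim≡2⇒independentRows : ∀ {s n} (C : Matrix Bool s 2) (V : Matrix Bool 2 n) → dim (C ·₂ V) ≡ 2 →
                          Σ (Fin s) λ t → Σ (Fin s) λ t′ → toℕ t < toℕ t′ ×
                            T (det₂ (C t zero) (C t (suc zero)) (C t′ zero) (C t′ (suc zero)))
  dim≡2⇒independentRows C V dim≡2 with rows , cols , rows∈ , _ , nz ← rank≡suc⇒NonzeroMinor (C ·₂ V) dim≡2 =
    rows zero , rows (suc zero) , choose-pair-increasing rows∈ ,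
    T-⇒ᵇ (allBits-sound 8 cauchyBinet _
      (a zero ∷ a (suc zero) ∷ b zero ∷ b (suc zero) ∷ u zero ∷ u (suc zero) ∷ v zero ∷ v (suc zero) ∷ [])) nz
    where
    a b : Fin 2 → Bool
    a i = C (rows i) zero
    b i = C (rows i) (suc zero)
    u v : Fin 2 → Bool
    u j = V zero (cols j)
    v j = V (suc zero) (cols j)
    cauchyBinet : Vec Bool 8 → Bool
    cauchyBinet (a₀ ∷ a₁ ∷ b₀ ∷ b₁ ∷ u₀ ∷ u₁ ∷ v₀ ∷ v₁ ∷ []) =
      not (not (det (rank2Form (lookup (a₀ ∷ a₁ ∷ [])) (lookup (b₀ ∷ b₁ ∷ []))
                               (lookup (u₀ ∷ u₁ ∷ [])) (lookup (v₀ ∷ v₁ ∷ [])))))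
        ⇒ᵇ det₂ a₀ b₀ a₁ b₁

module DirectSumOfM₁ where
  open DirectSum {4} {4} ρ₁ ρ₁ public
  open RankOver F₄-data using (∑; det; rank)
  open RankData F₄-data using (_*_; isZero)
  open RankLemmas F₄-data using (∑-cong; rank-cong; entry⇒1≤rank; minor₂⇒2≤rank)
  open RankLemmas F₂ using () renaming (rank-cong to dim-cong)
  open OverF₂ using (combination; det₂; dim-·₂-≤2; dim≡1⇒nonzeroRow; dim≡2⇒independentRows)

  Projection : Set
  Projection = (Fin 8 → Bool) → Fin 2 → F₄

  image₁ image₂ : Projection
  image₁ x i = ∑ λ l → G₁ i l * (if x (l ↑ˡ 4) then 𝟙 else 𝟘)
  image₂ x i = ∑ λ l → G₁ i l * (if x (4 ↑ʳ l) then 𝟙 else 𝟘)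

  imageRank : ∀ {s} → Projection → Matrix Bool s 8 → ℕ
  imageRank img X = rank λ i j → img (X j) i

  nonzeroImageAt : Projection → Matrix Bool 2 8 → Bool → Bool → Bool
  nonzeroImageAt img V p q = not (isZero (det {1} λ _ _ → img (combination V p q) zero)) ∨
                             not (isZero (det {1} λ _ _ → img (combination V p q) (suc zero)))

  NonzeroImage : Projection → Matrix Bool 2 8 → Set
  NonzeroImage img V = ∀ p q → T (p ∨ q) → T (nonzeroImageAt img V p q)

  independentImagesAt : Projection → Matrix Bool 2 8 → Bool → Bool → Bool → Bool → Bool
  independentImagesAt img V p q p′ q′ =
    not (isZero (det λ i j → img (combination V (pair p p′ j) (pair q q′ j)) i))

  IndependentImages : Projection → Matrix Bool 2 8 → Set
  IndependentImages img V = ∀ p q p′ q′ → T (det₂ p q p′ q′) → T (independentImagesAt img V p q p′ q′)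

  module _ (img : Projection) (V : Matrix Bool 2 8) {s} (C : Matrix Bool s 2) where

    nonzeroRow⇒1≤imageRank : NonzeroImage img V → ∀ c → T (C c zero ∨ C c (suc zero)) →
                              1 ≤ imageRank img (C ·₂ V)
    nonzeroRow⇒1≤imageRank nonzero c row≢0 with Equivalence.to T-∨ (nonzero (C c zero) (C c (suc zero)) row≢0)
    ... | inj₁ nz = entry⇒1≤rank (λ i j → img ((C ·₂ V) j) i) zero c nz
    ... | inj₂ nz = entry⇒1≤rank (λ i j → img ((C ·₂ V) j) i) (suc zero) c nz

    dim≤imageRank : NonzeroImage img V → IndependentImages img V → dim (C ·₂ V) ≤ imageRank img (C ·₂ V)
    dim≤imageRank nonzero independent with dim (C ·₂ V) in dim≡ | dim-·₂-≤2 C V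
    ... | 0 | _ = z≤n
    ... | 1 | _ with c , row≢0 ← dim≡1⇒nonzeroRow C V dim≡ = nonzeroRow⇒1≤imageRank nonzero c row≢0
    ... | 2 | _ with t , t′ , t<t′ , indep ← dim≡2⇒independentRows C V dim≡ =
      minor₂⇒2≤rank (λ i j → img ((C ·₂ V) j) i) {zero} {suc zero} (s≤s z≤n) t<t′
        (independent (C t zero) (C t (suc zero)) (C t′ zero) (C t′ (suc zero)) indep)
    ... | suc (suc (suc _)) | s≤s (s≤s ())

  NoSubspaceIn𝒳 : Matrix Bool 2 8 → Set
  NoSubspaceIn𝒳 V = ∀ {s} (C : Matrix Bool s 2) → dim (C ·₂ V) ≤ ρ₁′ (C ·₂ V) ℕ.+ ρ₂′ (C ·₂ V)

  noSubspaceIn𝒳-via-image₁ : ∀ V → NonzeroImage image₁ V → IndependentImages image₁ V → NoSubspaceIn𝒳 V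
  noSubspaceIn𝒳-via-image₁ V nonzero independent C =
    ℕ.≤-trans (dim≤imageRank image₁ V C nonzero independent) (ℕ.m≤m+n _ _)

  noSubspaceIn𝒳-via-image₂ : ∀ V → NonzeroImage image₂ V → IndependentImages image₂ V → NoSubspaceIn𝒳 V
  noSubspaceIn𝒳-via-image₂ V nonzero independent C =
    ℕ.≤-trans (dim≤imageRank image₂ V C nonzero independent) (ℕ.m≤n+m _ _)

  noSubspaceIn𝒳-via-both : ∀ V → NonzeroImage image₁ V → NonzeroImage image₂ V → NoSubspaceIn𝒳 V
  noSubspaceIn𝒳-via-both V nonzero₁ nonzero₂ C with dim (C ·₂ V) in dim≡ | dim-·₂-≤2 C V
  ... | 0 | _ = z≤n
  ... | 1 | _ with c , row≢0 ← dim≡1⇒nonzeroRow C V dim≡ =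
    ℕ.≤-trans (nonzeroRow⇒1≤imageRank image₁ V C nonzero₁ c row≢0) (ℕ.m≤m+n _ _)
  ... | 2 | _ with t , _ , _ , indep ← dim≡2⇒independentRows C V dim≡ =
    ℕ.+-mono-≤ (nonzeroRow⇒1≤imageRank image₁ V C nonzero₁ t row≢0)
               (nonzeroRow⇒1≤imageRank image₂ V C nonzero₂ t row≢0)
    where
    independent⇒nonzero : ∀ p q {p′ q′} → T (det₂ p q p′ q′) → T (p ∨ q)
    independent⇒nonzero true  _    _ = _
    independent⇒nonzero false true _ = _
    row≢0 : T (C t zero ∨ C t (suc zero))
    row≢0 = independent⇒nonzero (C t zero) (C t (suc zero)) indep
  ... | suc (suc (suc _)) | s≤s (s≤s ())

  image₁-cong : ∀ {x y} → (∀ l → x l ≡ y l) → ∀ i → image₁ x i ≡ image₁ y i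
  image₁-cong x≗y i = ∑-cong λ l → ≡.cong (λ b → G₁ i l * (if b then 𝟙 else 𝟘)) (x≗y (l ↑ˡ 4))
  image₂-cong : ∀ {x y} → (∀ l → x l ≡ y l) → ∀ i → image₂ x i ≡ image₂ y i
  image₂-cong x≗y i = ∑-cong λ l → ≡.cong (λ b → G₁ i l * (if b then 𝟙 else 𝟘)) (x≗y (4 ↑ʳ l))

  ρ′-cong : ∀ {s} {X Y : Matrix Bool s 8} → (∀ i j → X i j ≡ Y i j) → ρ₁′ X ℕ.+ ρ₂′ X ≡ ρ₁′ Y ℕ.+ ρ₂′ Y
  ρ′-cong X≗Y = ≡.cong₂ ℕ._+_ (rank-cong λ i j → image₁-cong (X≗Y j) i)
                              (rank-cong λ i j → image₂-cong (X≗Y j) i)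

  2≤rank-of-noSubspaceIn𝒳 : ∀ {V v} → dim V ≡ 2 → NoSubspaceIn𝒳 V → RankIs V v → 2 ≤ v
  2≤rank-of-noSubspaceIn𝒳 {V} {v} dimV≡2 _ ((_ , X , _ , inj₂ dimX≡0 , v≡) , _) =
    ≡.subst (2 ≤_) (≡.sym v≡2+) (ℕ.m≤m+n 2 _)
    where
    v≡2+ : v ≡ 2 ℕ.+ (ρ₁′ X ℕ.+ ρ₂′ X)
    v≡2+ = ≡.trans v≡ (≡.cong₂ (λ d e → (d ℕ.+ (ρ₁′ X ℕ.+ ρ₂′ X)) ℕ.∸ e) dimV≡2 dimX≡0)
  2≤rank-of-noSubspaceIn𝒳 {V} _ free ((_ , X , (C , X≗CV) , inj₁ X∈𝒳 , _) , _) =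
    ⊥-elim (ℕ.<⇒≱ (≡.subst₂ _<_ (ρ′-cong X≗CV) (dim-cong X≗CV) X∈𝒳) (free C))

  rank≤candidate : ∀ {V v} → In𝒳₀ V → RankIs V v → v ≤ candidate V V
  rank≤candidate {V} V∈𝒳₀ (_ , minimal) = minimal V (identity , V≗identity·V) V∈𝒳₀
    where
    identity : Matrix Bool 2 2
    identity zero       zero       = true
    identity zero       (suc zero) = false
    identity (suc zero) zero       = false
    identity (suc zero) (suc zero) = true
    V≗identity·V : ∀ i j → V i j ≡ (identity ·₂ V) i j
    V≗identity·V zero       j = ≡.sym (xor-identityʳ _)
    V≗identity·V (suc zero) j = ≡.sym (xor-identityʳ _)

  nonzeroImage? : Projection → Matrix Bool 2 8 → Vec Bool 2 → Bool
  nonzeroImage? img V (p ∷ q ∷ []) = (p ∨ q) ⇒ᵇ nonzeroImageAt img V p q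

  nonzeroImage-by-evaluation : ∀ img V → T (allBits 2 (nonzeroImage? img V)) → NonzeroImage img V
  nonzeroImage-by-evaluation img V holds p q = T-⇒ᵇ (allBits-sound 2 (nonzeroImage? img V) holds (p ∷ q ∷ []))

  independentImages? : Projection → Matrix Bool 2 8 → Vec Bool 4 → Bool
  independentImages? img V (p ∷ q ∷ p′ ∷ q′ ∷ []) = det₂ p q p′ q′ ⇒ᵇ independentImagesAt img V p q p′ q′

  independentImages-by-evaluation : ∀ img V → T (allBits 4 (independentImages? img V)) → IndependentImages img V
  independentImages-by-evaluation img V holds p q p′ q′ =
    T-⇒ᵇ (allBits-sound 4 (independentImages? img V) holds (p ∷ q ∷ p′ ∷ q′ ∷ []))

  isRankOneLine : Matrix Bool 2 8 → Bool
  isRankOneLine V = (ρ₁′ V ℕ.+ ρ₂′ V ℕ.<ᵇ dim V) ∧ (candidate V V ℕ.≡ᵇ 1)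

  rank≤1-of-rankOneLine : ∀ {V v} → T (isRankOneLine V) → RankIs V v → v ≤ 1
  rank≤1-of-rankOneLine {V} {v} isRankOne rankIs with V∈𝒳 , candidate≡1 ← Equivalence.to T-∧ isRankOne =
    ≡.subst (v ≤_) (ℕ.≡ᵇ⇒≡ (candidate V V) 1 candidate≡1)
      (rank≤candidate {V} (inj₁ (ℕ.<ᵇ⇒< (ρ₁′ V ℕ.+ ρ₂′ V) (dim V) V∈𝒳)) rankIs)

  embedˡ embedʳ : Matrix Bool 2 4 → Matrix Bool 2 8
  embedˡ L i = L i ++ ∅ {4}
  embedʳ L i = ∅ {4} ++ L i

  spread-rankOne : ∀ i → T (isRankOneLine (embedˡ (spread i)) ∧ isRankOneLine (embedʳ (spread i)))
  spread-rankOne zero                         = _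
  spread-rankOne (suc zero)                   = _
  spread-rankOne (suc (suc zero))             = _
  spread-rankOne (suc (suc (suc zero)))       = _
  spread-rankOne (suc (suc (suc (suc zero)))) = _

  diagonal twisted : Matrix Bool 2 8
  diagonal = pair (e₀ ++ e₀) (e₁ ++ e₁)
  twisted  = pair (e₀ ++ e₀) (e₁ ++ (e₀ ∪ e₁))

  e₀e₂ˡ-noSubspaceIn𝒳 : NoSubspaceIn𝒳 (embedˡ (pair e₀ e₂))
  e₀e₂ˡ-noSubspaceIn𝒳 = noSubspaceIn𝒳-via-image₁ V (nonzeroImage-by-evaluation image₁ V _)
                                                   (independentImages-by-evaluation image₁ V _)
    where
    V : Matrix Bool 2 8
    V = embedˡ (pair e₀ e₂)

  e₀e₂ʳ-noSubspaceIn𝒳 : NoSubspaceIn𝒳 (embedʳ (pair e₀ e₂))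
  e₀e₂ʳ-noSubspaceIn𝒳 = noSubspaceIn𝒳-via-image₂ V (nonzeroImage-by-evaluation image₂ V _)
                                                   (independentImages-by-evaluation image₂ V _)
    where
    V : Matrix Bool 2 8
    V = embedʳ (pair e₀ e₂)

  diagonal-noSubspaceIn𝒳 : NoSubspaceIn𝒳 diagonal
  diagonal-noSubspaceIn𝒳 = noSubspaceIn𝒳-via-both diagonal (nonzeroImage-by-evaluation image₁ diagonal _)
                                                   (nonzeroImage-by-evaluation image₂ diagonal _)

  twisted-noSubspaceIn𝒳 : NoSubspaceIn𝒳 twisted
  twisted-noSubspaceIn𝒳 = noSubspaceIn𝒳-via-both twisted (nonzeroImage-by-evaluation image₁ twisted _)
                                                 (nonzeroImage-by-evaluation image₂ twisted _)

module OverField (K : Field) {N : ℕ} (fin : FiniteOfOrder K N) where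
  open Field K hiding (zero) renaming (refl to ≈-refl; sym to ≈-sym; trans to ≈-trans)
  open IntegerCoefficientSolver commutativeRing using (Polynomial; solve; _:=_; _:+_; _:*_; _:-_; :-_; con)
  open import Algebra.Properties.Ring ring using (x≈y⇒x∙y⁻¹≈ε; x∙y⁻¹≈ε⇒x≈y)
  open import Algebra.Properties.CommutativeSemigroup +-commutativeSemigroup using (interchange)
  open import Relation.Binary.Reasoning.Setoid setoid

  private
    KD : RankData
    KD = rankDataOf K fin

  open RankOver KD using (∑; det; rank)
  open RankLemmas KD using (NonzeroMinor; rank≡0⊎NonzeroMinor; NonzeroMinor⇒≤cols; minor₂⇒2≤rank; choose-2-2)

  0ₚ 1ₚ : ∀ {n} → Polynomial n
  0ₚ = con (+ 0)
  1ₚ = con (+ 1)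

  Vector : ℕ → Set
  Vector k = Fin k → Carrier

  Parallel : ∀ {k} → Vector k → Vector k → Set
  Parallel u w = ∀ t t′ → u t * w t′ ≈ u t′ * w t

  Independent : ∀ {k} → Vector k → Vector k → Set
  Independent {k} u w = Σ (Fin k) λ t → Σ (Fin k) λ t′ → ¬ (u t * w t′ ≈ u t′ * w t)

  det₂≈ : (A : Matrix Carrier 2 2) →
          det A ≈ A zero zero * A (suc zero) (suc zero) - A zero (suc zero) * A (suc zero) zero
  det₂≈ A = solve 4 (λ a b c d → a :* (d :* 1ₚ :+ 0ₚ) :+ (:- (b :* (c :* 1ₚ :+ 0ₚ)) :+ 0ₚ)
                                 := a :* d :- b :* c)
                    ≈-refl (A zero zero) (A zero (suc zero)) (A (suc zero) zero) (A (suc zero) (suc zero))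

  ≉0⇒nonzero : ∀ {x} → ¬ x ≈ 0# → T (not (RankData.isZero KD x))
  ≉0⇒nonzero {x} x≉0 = ≡.subst (T ∘ not) (≡.sym (dec-false (decZero K fin x) x≉0)) _

  nonzero⇒≉0 : ∀ {x} → T (not (RankData.isZero KD x)) → ¬ x ≈ 0#
  nonzero⇒≉0 {x} nz x≈0 = ≡.subst (T ∘ not) (dec-true (decZero K fin x) x≈0) nz

  minor₂≈ : ∀ {k} (A : Matrix Carrier k 2) t t′ →
            RankLemmas.minor KD A (pair t t′) (pair zero (suc zero)) ≈
            A t zero * A t′ (suc zero) - A t (suc zero) * A t′ zero
  minor₂≈ A t t′ = det₂≈ λ i j → A (pair t t′ i) (pair zero (suc zero) j)

  minor₂≈0⇔proportional : ∀ {k} (A : Matrix Carrier k 2) t t′ →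
    RankLemmas.minor KD A (pair t t′) (pair zero (suc zero)) ≈ 0# ⇔
    A t zero * A t′ (suc zero) ≈ A t′ zero * A t (suc zero)
  minor₂≈0⇔proportional A t t′ = mk⇔
    (λ m≈0 → ≈-trans (x∙y⁻¹≈ε⇒x≈y _ _ (≈-trans (≈-sym (minor₂≈ A t t′)) m≈0)) (*-comm _ _))
    (λ par → ≈-trans (minor₂≈ A t t′) (x≈y⇒x∙y⁻¹≈ε (≈-trans par (*-comm _ _))))

  rank≤1⇒minor₂-vanishes : ∀ {k} (A : Matrix Carrier k 2) → rank A ≤ 1 → ∀ {t t′} → toℕ t < toℕ t′ →
                           A t zero * A t′ (suc zero) ≈ A t′ zero * A t (suc zero)
  rank≤1⇒minor₂-vanishes A rank≤1 {t} {t′} t<t′ = Equivalence.to (minor₂≈0⇔proportional A t t′)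
    (decidable-stable (decZero K fin m) λ m≉0 →
      ℕ.<⇒≱ (s≤s rank≤1) (minor₂⇒2≤rank A {j = zero} {suc zero} t<t′ (s≤s z≤n) (≉0⇒nonzero m≉0)))
    where
    m : Carrier
    m = RankLemmas.minor KD A (pair t t′) (pair zero (suc zero))

  rank≤1⇒Parallel : ∀ {k} (A : Matrix Carrier k 2) → rank A ≤ 1 →
                    Parallel (λ t → A t zero) (λ t → A t (suc zero))
  rank≤1⇒Parallel A rank≤1 t t′ with Fin.<-cmp t t′
  ... | tri< t<t′ _ _ = rank≤1⇒minor₂-vanishes A rank≤1 t<t′
  ... | tri≈ _ ≡.refl _ = ≈-refl
  ... | tri> _ _ t′<t = ≈-sym (rank≤1⇒minor₂-vanishes A rank≤1 t′<t)

  2≤rank⇒Independent : ∀ {k} (A : Matrix Carrier k 2) → 2 ≤ rank A →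
                       Independent (λ t → A t zero) (λ t → A t (suc zero))
  2≤rank⇒Independent A 2≤rank with rank≡0⊎NonzeroMinor A
  ... | inj₁ rank≡0  = ⊥-elim (ℕ.<⇒≱ (≡.subst (1 ≤_) rank≡0 (ℕ.≤-trans (s≤s z≤n) 2≤rank)) z≤n)
  ... | inj₂ minorA
    with rows , cols , _ , cols∈ , nz ←
           ≡.subst (NonzeroMinor A) (ℕ.≤-antisym (NonzeroMinor⇒≤cols {A = A} minorA) 2≤rank) minorA
    = rows zero , rows (suc zero) , λ par → nonzero⇒≉0 nz (begin
        RankLemmas.minor KD A rows cols
          ≡⟨ RankLemmas.minor-cong KD A (λ i → pair-η rows i) (choose-2-2 cols∈) ⟩
        RankLemmas.minor KD A (pair (rows zero) (rows (suc zero))) (pair zero (suc zero))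
          ≈⟨ Equivalence.from (minor₂≈0⇔proportional A (rows zero) (rows (suc zero))) par ⟩
        0# ∎)

  x*d≈0⇒x≈0 : ∀ {x d} → ¬ d ≈ 0# → x * d ≈ 0# → x ≈ 0#
  x*d≈0⇒x≈0 {x} {d} d≉0 xd≈0 with d⁻¹ , dd⁻¹≈1 ← inverse d d≉0 = begin
    x              ≈⟨ *-identityʳ x ⟨
    x * 1#         ≈⟨ *-congˡ dd⁻¹≈1 ⟨
    x * (d * d⁻¹)  ≈⟨ *-assoc x d d⁻¹ ⟨
    (x * d) * d⁻¹  ≈⟨ *-congʳ xd≈0 ⟩
    0# * d⁻¹       ≈⟨ zeroˡ d⁻¹ ⟩
    0#             ∎

  Parallel-cong : ∀ {k} {u u′ w w′ : Vector k} → (∀ t → u t ≈ u′ t) → (∀ t → w t ≈ w′ t) →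
                  Parallel u w → Parallel u′ w′
  Parallel-cong u≈ w≈ par t t′ =
    ≈-trans (≈-sym (*-cong (u≈ t) (w≈ t′))) (≈-trans (par t t′) (*-cong (u≈ t′) (w≈ t)))

  Independent-cong : ∀ {k} {u u′ w w′ : Vector k} → (∀ t → u t ≈ u′ t) → (∀ t → w t ≈ w′ t) →
                     Independent u w → Independent u′ w′
  Independent-cong u≈ w≈ (t , t′ , ¬par) =
    t , t′ , λ par → ¬par (≈-trans (*-cong (u≈ t) (w≈ t′)) (≈-trans par (≈-sym (*-cong (u≈ t′) (w≈ t)))))

  Parallel⇒¬Independent : ∀ {k} {u w : Vector k} → Parallel u w → ¬ Independent u w
  Parallel⇒¬Independent par (t , t′ , ¬par) = ¬par (par t t′)

  multiple⇒Parallel : ∀ {k} {u w : Vector k} c → (∀ t → w t ≈ c * u t) → Parallel u w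
  multiple⇒Parallel {u = u} {w} c w≈cu t t′ = begin
    u t * w t′        ≈⟨ *-congˡ (w≈cu t′) ⟩
    u t * (c * u t′)  ≈⟨ solve 3 (λ x c y → x :* (c :* y) := y :* (c :* x)) ≈-refl (u t) c (u t′) ⟩
    u t′ * (c * u t)  ≈⟨ *-congˡ (w≈cu t) ⟨
    u t′ * w t        ∎

  Parallel⇒multiple : ∀ {k} {u w : Vector k} → Parallel u w → ∀ r → ¬ u r ≈ 0# →
                      Σ Carrier λ c → ∀ t → w t ≈ c * u t
  Parallel⇒multiple {u = u} {w} par r ur≉0 with ur⁻¹ , urur⁻¹≈1 ← inverse (u r) ur≉0 = w r * ur⁻¹ , λ t → begin
    w t                       ≈⟨ *-identityʳ (w t) ⟨
    w t * 1#                  ≈⟨ *-congˡ urur⁻¹≈1 ⟨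
    w t * (u r * ur⁻¹)        ≈⟨ solve 3 (λ x y i → x :* (y :* i) := (y :* x) :* i) ≈-refl (w t) (u r) ur⁻¹ ⟩
    (u r * w t) * ur⁻¹        ≈⟨ *-congʳ (par r t) ⟩
    (u t * w r) * ur⁻¹        ≈⟨ solve 3 (λ x y i → (x :* y) :* i := (y :* i) :* x) ≈-refl (u t) (w r) ur⁻¹ ⟩
    (w r * ur⁻¹) * u t        ∎

  Independent⇒nonzero : ∀ {k} {u w : Vector k} → Independent u w → Σ (Fin k) λ r → ¬ u r ≈ 0#
  Independent⇒nonzero {u = u} (t , t′ , ¬par) with decZero K fin (u t) | decZero K fin (u t′)
  ... | no ut≉0 | _        = t , ut≉0
  ... | yes _   | no ut′≉0 = t′ , ut′≉0
  ... | yes ut≈0 | yes ut′≈0 =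
    ⊥-elim (¬par (≈-trans (≈-trans (*-congʳ ut≈0) (zeroˡ _)) (≈-sym (≈-trans (*-congʳ ut′≈0) (zeroˡ _)))))

  Independent-sym : ∀ {k} {u w : Vector k} → Independent u w → Independent w u
  Independent-sym (t , t′ , ¬par) = t′ , t , λ par → ¬par (≈-trans (*-comm _ _) (≈-trans par (*-comm _ _)))

  Parallel⇒coordinateDet≈0 : ∀ {k} {p q u w : Vector k} {x y x′ y′} → Independent p q →
    (∀ t → u t ≈ x * p t + y * q t) → (∀ t → w t ≈ x′ * p t + y′ * q t) →
    Parallel u w → x * y′ - x′ * y ≈ 0#
  Parallel⇒coordinateDet≈0 {p = p} {q} {u} {w} {x} {y} {x′} {y′} (t , t′ , ¬par) u≈ w≈ par =
    x*d≈0⇒x≈0 (λ D≈0 → ¬par (x∙y⁻¹≈ε⇒x≈y _ _ D≈0)) (begin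
      (x * y′ - x′ * y) * (p t * q t′ - p t′ * q t)
        ≈⟨ solve 8 (λ x y x′ y′ a b a′ b′ →
                      (x :* y′ :- x′ :* y) :* (a :* b′ :- a′ :* b)
                      := (x :* a :+ y :* b) :* (x′ :* a′ :+ y′ :* b′)
                         :- (x :* a′ :+ y :* b′) :* (x′ :* a :+ y′ :* b))
                   ≈-refl x y x′ y′ (p t) (q t) (p t′) (q t′) ⟩
      (x * p t + y * q t) * (x′ * p t′ + y′ * q t′) - (x * p t′ + y * q t′) * (x′ * p t + y′ * q t)
        ≈⟨ +-cong (*-cong (u≈ t) (w≈ t′)) (-‿cong (*-cong (u≈ t′) (w≈ t))) ⟨
      u t * w t′ - u t′ * w t
        ≈⟨ x≈y⇒x∙y⁻¹≈ε (par t t′) ⟩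
      0# ∎)

  ⌊_⌋ : Bool → Carrier
  ⌊ b ⌋ = if b then 1# else 0#

  image : ∀ {k n} → Matrix Carrier k n → (Fin n → Bool) → Vector k
  image G y t = ∑ λ l → G t l * ⌊ y l ⌋

  ∑-cong≈ : ∀ {n} {f g : Fin n → Carrier} → (∀ i → f i ≈ g i) → ∑ f ≈ ∑ g
  ∑-cong≈ {zero}  _   = ≈-refl
  ∑-cong≈ {suc n} f≈g = +-cong (f≈g zero) (∑-cong≈ (f≈g ∘ suc))

  ∑-↑ : ∀ m {n} (f : Fin (m ℕ.+ n) → Carrier) → ∑ f ≈ ∑ (f ∘ (_↑ˡ n)) + ∑ (f ∘ (m ↑ʳ_))
  ∑-↑ zero    f = ≈-sym (+-identityˡ _)
  ∑-↑ (suc m) f = ≈-trans (+-congˡ (∑-↑ m (f ∘ suc))) (≈-sym (+-assoc _ _ _))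

  image-++ : ∀ {k m n} (G : Matrix Carrier k (m ℕ.+ n)) x y t →
             image G (x ++ y) t ≈ image (λ t l → G t (l ↑ˡ n)) x t + image (λ t l → G t (m ↑ʳ l)) y t
  image-++ {m = m} {n} G x y t = ≈-trans (∑-↑ m _) (+-cong
    (∑-cong≈ λ l → reflexive (≡.cong (λ b → G t (l ↑ˡ n) * ⌊ b ⌋) (lookup-++ˡ x y l)))
    (∑-cong≈ λ l → reflexive (≡.cong (λ b → G t (m ↑ʳ l) * ⌊ b ⌋) (lookup-++ʳ x y l))))

  image-empty : ∀ {k n} (G : Matrix Carrier k n) t → image G ∅ t ≈ 0#
  image-empty {n = zero}  G t = ≈-refl
  image-empty {n = suc n} G t =
    ≈-trans (+-cong (zeroʳ (G t zero)) (image-empty (λ t l → G t (suc l)) t)) (+-identityʳ 0#)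

  ⌊⌋-∪ : ∀ a b → T (not (a ∧ b)) → ⌊ a ∨ b ⌋ ≈ ⌊ a ⌋ + ⌊ b ⌋
  ⌊⌋-∪ true  false _ = ≈-sym (+-identityʳ 1#)
  ⌊⌋-∪ false true  _ = ≈-sym (+-identityˡ 1#)
  ⌊⌋-∪ false false _ = ≈-sym (+-identityʳ 0#)

  image-∪ : ∀ {k n} (H : Matrix Carrier k n) (y y′ : Fin n → Bool) → T (disjoint y y′) → ∀ t →
            image H (y ∪ y′) t ≈ image H y t + image H y′ t
  image-∪ {n = zero}  H y y′ _ t = ≈-sym (+-identityʳ 0#)
  image-∪ {n = suc n} H y y′ disj t = begin
    H t zero * ⌊ y zero ∨ y′ zero ⌋ + image H′ ((y ∘ suc) ∪ (y′ ∘ suc)) t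
      ≈⟨ +-cong (≈-trans (*-congˡ (⌊⌋-∪ (y zero) (y′ zero) (proj₁ disj′))) (distribˡ _ _ _))
                (image-∪ H′ (y ∘ suc) (y′ ∘ suc) (proj₂ disj′) t) ⟩
    (H t zero * ⌊ y zero ⌋ + H t zero * ⌊ y′ zero ⌋) + (image H′ (y ∘ suc) t + image H′ (y′ ∘ suc) t)
      ≈⟨ interchange _ _ _ _ ⟩
    image H y t + image H y′ t ∎
    where
    H′ : Matrix Carrier _ n
    H′ t l = H t (suc l)
    disj′ : T (not (y zero ∧ y′ zero)) × T (disjoint (y ∘ suc) (y′ ∘ suc))
    disj′ = Equivalence.to T-∧ disj

  ω-Multiple : ∀ {k} → Vector k → Vector k → Set
  ω-Multiple u w = Σ Carrier λ α → α * α + α + 1# ≈ 0# × (∀ t → w t ≈ α * u t)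

  module _ {k} (H : Matrix Carrier k 4)
           (parallel : ∀ i → Parallel (image H (spread i zero)) (image H (spread i (suc zero))))
           (independent : Independent (image H e₀) (image H e₂)) where

    private
      p q : Vector k
      p = image H e₀
      q = image H e₂

      HasCoordinates : Vector k → Carrier → Carrier → Set
      HasCoordinates u x y = ∀ t → u t ≈ x * p t + y * q t

      e₁-multiple : Σ Carrier λ a → ∀ t → image H e₁ t ≈ a * p t
      e₁-multiple = Parallel⇒multiple (parallel zero) _ (proj₂ (Independent⇒nonzero independent))

      e₀₁₃-multiple : Σ Carrier λ b → ∀ t → image H (e₀ ∪ (e₁ ∪ e₃)) t ≈ b * q t
      e₀₁₃-multiple =
        Parallel⇒multiple (parallel (suc zero)) _ (proj₂ (Independent⇒nonzero (Independent-sym independent)))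

      a b : Carrier
      a = proj₁ e₁-multiple
      b = proj₁ e₀₁₃-multiple

      e₁≈a·e₀ : ∀ t → image H e₁ t ≈ a * p t
      e₁≈a·e₀ = proj₂ e₁-multiple

      e₀₁₃≈b·e₂ : ∀ t → image H (e₀ ∪ (e₁ ∪ e₃)) t ≈ b * q t
      e₀₁₃≈b·e₂ = proj₂ e₀₁₃-multiple

      coordinates₀ : HasCoordinates (image H e₀) 1# 0#
      coordinates₀ t = solve 2 (λ x y → x := 1ₚ :* x :+ 0ₚ :* y) ≈-refl (p t) (q t)

      coordinates₁ : HasCoordinates (image H e₁) a 0#
      coordinates₁ t =
        ≈-trans (e₁≈a·e₀ t) (solve 3 (λ a x y → a :* x := a :* x :+ 0ₚ :* y) ≈-refl a (p t) (q t))

      coordinates₂ : HasCoordinates (image H e₂) 0# 1#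
      coordinates₂ t = solve 2 (λ x y → y := 0ₚ :* x :+ 1ₚ :* y) ≈-refl (p t) (q t)

      coordinates₃ : HasCoordinates (image H e₃) (- (1# + a)) b
      coordinates₃ t = begin
        image H e₃ t
          ≈⟨ solve 3 (λ x₀ x₁ x₃ → x₃ := (x₀ :+ (x₁ :+ x₃)) :- (x₀ :+ x₁))
                   ≈-refl (p t) (image H e₁ t) (image H e₃ t) ⟩
        (p t + (image H e₁ t + image H e₃ t)) - (p t + image H e₁ t)
          ≈⟨ +-cong (≈-trans (≈-sym e₀₁₃≈sum) (e₀₁₃≈b·e₂ t)) (-‿cong (+-congˡ (e₁≈a·e₀ t))) ⟩
        b * q t - (p t + a * p t)
          ≈⟨ solve 4 (λ a b x y → b :* y :- (x :+ a :* x) := :- (1ₚ :+ a) :* x :+ b :* y)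
                   ≈-refl a b (p t) (q t) ⟩
        - (1# + a) * p t + b * q t ∎
        where
        e₀₁₃≈sum : image H (e₀ ∪ (e₁ ∪ e₃)) t ≈ p t + (image H e₁ t + image H e₃ t)
        e₀₁₃≈sum = ≈-trans (image-∪ H e₀ (e₁ ∪ e₃) _ t) (+-congˡ (image-∪ H e₁ e₃ _ t))

      coordinates-∪ : ∀ y y′ {x z x′ z′} → T (disjoint y y′) →
                      HasCoordinates (image H y) x z → HasCoordinates (image H y′) x′ z′ →
                      HasCoordinates (image H (y ∪ y′)) (x + x′) (z + z′)
      coordinates-∪ y y′ {x} {z} {x′} {z′} disj c c′ t = begin
        image H (y ∪ y′) t
          ≈⟨ image-∪ H y y′ disj t ⟩
        image H y t + image H y′ t
          ≈⟨ +-cong (c t) (c′ t) ⟩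
        (x * p t + z * q t) + (x′ * p t + z′ * q t)
          ≈⟨ solve 6 (λ x z x′ z′ u v → (x :* u :+ z :* v) :+ (x′ :* u :+ z′ :* v)
                                        := (x :+ x′) :* u :+ (z :+ z′) :* v)
                   ≈-refl x z x′ z′ (p t) (q t) ⟩
        (x + x′) * p t + (z + z′) * q t ∎

      E₃ E₄ E₅ : Carrier
      E₃ = (1# + 0#) * (0# + b) - (1# + - (1# + a)) * (0# + 1#)
      E₄ = (a + - (1# + a)) * (0# + (1# + b)) - (1# + (0# + - (1# + a))) * (0# + b)
      E₅ = - (1# + a) * (0# + (1# + b)) - (a + (0# + - (1# + a))) * b

      E₃ₚ E₄ₚ E₅ₚ : ∀ {n} → Polynomial n → Polynomial n → Polynomial n
      E₃ₚ a b = (1ₚ :+ 0ₚ) :* (0ₚ :+ b) :- (1ₚ :+ :- (1ₚ :+ a)) :* (0ₚ :+ 1ₚ)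
      E₄ₚ a b = (a :+ :- (1ₚ :+ a)) :* (0ₚ :+ (1ₚ :+ b)) :- (1ₚ :+ (0ₚ :+ :- (1ₚ :+ a))) :* (0ₚ :+ b)
      E₅ₚ a b = :- (1ₚ :+ a) :* (0ₚ :+ (1ₚ :+ b)) :- (a :+ (0ₚ :+ :- (1ₚ :+ a))) :* b

      E₃≈0 : E₃ ≈ 0#
      E₃≈0 = Parallel⇒coordinateDet≈0 independent
        (coordinates-∪ e₀ e₂ _ coordinates₀ coordinates₂) (coordinates-∪ e₀ e₃ _ coordinates₀ coordinates₃)
        (parallel (suc (suc zero)))

      E₄≈0 : E₄ ≈ 0#
      E₄≈0 = Parallel⇒coordinateDet≈0 independent
        (coordinates-∪ e₁ e₃ _ coordinates₁ coordinates₃)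
        (coordinates-∪ e₀ (e₂ ∪ e₃) _ coordinates₀ (coordinates-∪ e₂ e₃ _ coordinates₂ coordinates₃))
        (parallel (suc (suc (suc zero))))

      E₅≈0 : E₅ ≈ 0#
      E₅≈0 = Parallel⇒coordinateDet≈0 independent
        coordinates₃
        (coordinates-∪ e₁ (e₂ ∪ e₃) _ coordinates₁ (coordinates-∪ e₂ e₃ _ coordinates₂ coordinates₃))
        (parallel (suc (suc (suc (suc zero)))))

      1+1≈0 : 1# + 1# ≈ 0#
      1+1≈0 = begin
        1# + 1#                  ≈⟨ solve 2 (λ a b → 1ₚ :+ 1ₚ := :- E₃ₚ a b :- E₄ₚ a b :- E₅ₚ a b) ≈-refl a b ⟩
        - E₃ - E₄ - E₅           ≈⟨ +-cong (+-cong (-‿cong E₃≈0) (-‿cong E₄≈0)) (-‿cong E₅≈0) ⟩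
        - 0# - 0# - 0#           ≈⟨ solve 0 (:- 0ₚ :- 0ₚ :- 0ₚ := 0ₚ) ≈-refl ⟩
        0#                       ∎

      a²+a+1≈0 : a * a + a + 1# ≈ 0#
      a²+a+1≈0 = begin
        a * a + a + 1#
          ≈⟨ solve 2 (λ a b → a :* a :+ a :+ 1ₚ := :- E₄ₚ a b :+ (a :+ 1ₚ) :* E₃ₚ a b :- b :* (1ₚ :+ 1ₚ))
                   ≈-refl a b ⟩
        - E₄ + (a + 1#) * E₃ - b * (1# + 1#)
          ≈⟨ +-cong (+-cong (-‿cong E₄≈0) (*-congˡ E₃≈0)) (-‿cong (*-congˡ 1+1≈0)) ⟩
        - 0# + (a + 1#) * 0# - b * 0#
          ≈⟨ solve 2 (λ a b → :- 0ₚ :+ (a :+ 1ₚ) :* 0ₚ :- b :* 0ₚ := 0ₚ) ≈-refl a b ⟩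
        0# ∎

    spread⇒ω : ω-Multiple (image H e₀) (image H e₁) × 1# + 1# ≈ 0#
    spread⇒ω = (a , a²+a+1≈0 , e₁≈a·e₀) , 1+1≈0

  multiples⇒Parallel-+ : ∀ {k} {u₀ u₁ w₀ w₁ : Vector k} {α} →
                         (∀ t → u₁ t ≈ α * u₀ t) → (∀ t → w₁ t ≈ α * w₀ t) →
                         Parallel (λ t → u₀ t + w₀ t) (λ t → u₁ t + w₁ t)
  multiples⇒Parallel-+ {α = α} u₁≈ w₁≈ =
    multiple⇒Parallel α λ t → ≈-trans (+-cong (u₁≈ t) (w₁≈ t)) (≈-sym (distribˡ α _ _))

  distinct-roots⇒1+β≈α : ∀ {α β} → α * α + α + 1# ≈ 0# → β * β + β + 1# ≈ 0# → 1# + 1# ≈ 0# →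
                         ¬ α ≈ β → 1# + β ≈ α
  distinct-roots⇒1+β≈α {α} {β} α-root β-root 1+1≈0 α≉β = begin
    1# + β
      ≈⟨ solve 2 (λ α β → 1ₚ :+ β := α :+ ((α :+ β :+ 1ₚ) :- α :* (1ₚ :+ 1ₚ))) ≈-refl α β ⟩
    α + ((α + β + 1#) - α * (1# + 1#))
      ≈⟨ +-congˡ (+-cong α+β+1≈0 (-‿cong (*-congˡ 1+1≈0))) ⟩
    α + (0# - α * 0#)
      ≈⟨ solve 1 (λ α → α :+ (0ₚ :- α :* 0ₚ) := α) ≈-refl α ⟩
    α ∎
    where
    α+β+1≈0 : α + β + 1# ≈ 0#
    α+β+1≈0 = x*d≈0⇒x≈0 (λ α-β≈0 → α≉β (x∙y⁻¹≈ε⇒x≈y α β α-β≈0)) (begin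
      (α + β + 1#) * (α - β)
        ≈⟨ solve 2 (λ α β → (α :+ β :+ 1ₚ) :* (α :- β) := (α :* α :+ α :+ 1ₚ) :- (β :* β :+ β :+ 1ₚ)) ≈-refl α β ⟩
      (α * α + α + 1#) - (β * β + β + 1#)
        ≈⟨ +-cong α-root (-‿cong β-root) ⟩
      0# - 0#
        ≈⟨ -‿inverseʳ 0# ⟩
      0# ∎)

  diagonal-or-twisted-Parallel : ∀ {k} {u₀ u₁ w₀ w₁ : Vector k} →
    ω-Multiple u₀ u₁ → ω-Multiple w₀ w₁ → 1# + 1# ≈ 0# →
    Parallel (λ t → u₀ t + w₀ t) (λ t → u₁ t + w₁ t) ⊎ Parallel (λ t → u₀ t + w₀ t) (λ t → u₁ t + (w₀ t + w₁ t))
  diagonal-or-twisted-Parallel {w₀ = w₀} {w₁} (α , α-root , u₁≈) (β , β-root , w₁≈) 1+1≈0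
    with decZero K fin (α - β)
  ... | yes α-β≈0 = inj₁ (multiples⇒Parallel-+ u₁≈ λ t →
    ≈-trans (w₁≈ t) (*-congʳ (≈-sym (x∙y⁻¹≈ε⇒x≈y α β α-β≈0))))
  ... | no  α-β≉0 = inj₂ (multiples⇒Parallel-+ u₁≈ λ t → begin
    w₀ t + w₁ t          ≈⟨ +-cong (≈-sym (*-identityˡ (w₀ t))) (w₁≈ t) ⟩
    1# * w₀ t + β * w₀ t ≈⟨ distribʳ (w₀ t) 1# β ⟨
    (1# + β) * w₀ t      ≈⟨ *-congʳ (distinct-roots⇒1+β≈α α-root β-root 1+1≈0 (α-β≉0 ∘ x≈y⇒x∙y⁻¹≈ε)) ⟩
    α * w₀ t             ∎)

module Representation (K : Field) {N : ℕ} (fin : FiniteOfOrder K N) {k : ℕ} (G : Matrix (Field.Carrier K) k 8)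
  (represents : ∀ {r} (Y : Matrix Bool r 8) → DirectSumOfM₁.RankIs Y (ρ[ K , fin ] G Y)) where
  open Field K using (Carrier; _≈_; _+_; 0#; 1#; trans; +-congˡ; +-congʳ; +-identityˡ; +-identityʳ)
  open OverField K fin
  open DirectSumOfM₁

  Gˡ Gʳ : Matrix Carrier k 4
  Gˡ t l = G t (l ↑ˡ 4)
  Gʳ t l = G t (4 ↑ʳ l)

  rankOne⇒Parallel : ∀ {V} → T (isRankOneLine V) → Parallel (image G (V zero)) (image G (V (suc zero)))
  rankOne⇒Parallel {V} isRankOne =
    rank≤1⇒Parallel (λ t j → image G (V j) t) (rank≤1-of-rankOneLine {V} isRankOne (represents V))

  noSubspaceIn𝒳⇒Independent : ∀ {V} → dim V ≡ 2 → NoSubspaceIn𝒳 V →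
                               Independent (image G (V zero)) (image G (V (suc zero)))
  noSubspaceIn𝒳⇒Independent {V} dimV≡2 free =
    2≤rank⇒Independent (λ t j → image G (V j) t) (2≤rank-of-noSubspaceIn𝒳 {V} dimV≡2 free (represents V))

  image-embedˡ : ∀ y t → image G (y ++ ∅ {4}) t ≈ image Gˡ y t
  image-embedˡ y t =
    trans (image-++ {m = 4} {n = 4} G y ∅ t) (trans (+-congˡ (image-empty Gʳ t)) (+-identityʳ _))

  image-embedʳ : ∀ y t → image G (∅ {4} ++ y) t ≈ image Gʳ y t
  image-embedʳ y t =
    trans (image-++ {m = 4} {n = 4} G ∅ y t) (trans (+-congʳ (image-empty Gˡ t)) (+-identityˡ _))

  spread-Parallel : ∀ i → Parallel (image Gˡ (spread i zero)) (image Gˡ (spread i (suc zero)))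
                        × Parallel (image Gʳ (spread i zero)) (image Gʳ (spread i (suc zero)))
  spread-Parallel i with isRankOneˡ , isRankOneʳ ← Equivalence.to T-∧ (spread-rankOne i) =
    Parallel-cong (image-embedˡ (spread i zero)) (image-embedˡ (spread i (suc zero)))
                  (rankOne⇒Parallel {embedˡ (spread i)} isRankOneˡ) ,
    Parallel-cong (image-embedʳ (spread i zero)) (image-embedʳ (spread i (suc zero)))
                  (rankOne⇒Parallel {embedʳ (spread i)} isRankOneʳ)

  e₀e₂-Independentˡ : Independent (image Gˡ e₀) (image Gˡ e₂)
  e₀e₂-Independentˡ = Independent-cong (image-embedˡ e₀) (image-embedˡ e₂)
    (noSubspaceIn𝒳⇒Independent {embedˡ (pair e₀ e₂)} ≡.refl e₀e₂ˡ-noSubspaceIn𝒳)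

  e₀e₂-Independentʳ : Independent (image Gʳ e₀) (image Gʳ e₂)
  e₀e₂-Independentʳ = Independent-cong (image-embedʳ e₀) (image-embedʳ e₂)
    (noSubspaceIn𝒳⇒Independent {embedʳ (pair e₀ e₂)} ≡.refl e₀e₂ʳ-noSubspaceIn𝒳)

  diagonal-Independent : Independent (λ t → image Gˡ e₀ t + image Gʳ e₀ t) (λ t → image Gˡ e₁ t + image Gʳ e₁ t)
  diagonal-Independent = Independent-cong (image-++ G e₀ e₀) (image-++ G e₁ e₁)
    (noSubspaceIn𝒳⇒Independent {diagonal} ≡.refl diagonal-noSubspaceIn𝒳)

  twisted-Independent : Independent (λ t → image Gˡ e₀ t + image Gʳ e₀ t)
                                    (λ t → image Gˡ e₁ t + (image Gʳ e₀ t + image Gʳ e₁ t))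
  twisted-Independent = Independent-cong (image-++ G e₀ e₀)
    (λ t → trans (image-++ G e₁ (e₀ ∪ e₁) t) (+-congˡ (image-∪ Gʳ e₀ e₁ _ t)))
    (noSubspaceIn𝒳⇒Independent {twisted} ≡.refl twisted-noSubspaceIn𝒳)

  ωˡ : ω-Multiple (image Gˡ e₀) (image Gˡ e₁) × 1# + 1# ≈ 0#
  ωˡ = spread⇒ω Gˡ (λ i → proj₁ (spread-Parallel i)) e₀e₂-Independentˡ

  ωʳ : ω-Multiple (image Gʳ e₀) (image Gʳ e₁) × 1# + 1# ≈ 0#
  ωʳ = spread⇒ω Gʳ (λ i → proj₂ (spread-Parallel i)) e₀e₂-Independentʳ

  impossible : ⊥
  impossible = [ (λ par → Parallel⇒¬Independent par diagonal-Independent)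
               , (λ par → Parallel⇒¬Independent par twisted-Independent) ]′
               (diagonal-or-twisted-Parallel (proj₁ ωˡ) (proj₁ ωʳ) (proj₂ ωˡ))

proposition3p7 : ∀ (m : ℕ) → ¬ RepresentableOver m 8 (DirectSum.RankIs ρ₁ ρ₁)
proposition3p7 m (K , fin , k , G , represents) = Representation.impossible K fin G represents
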